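{- Let $(P,\le)$ be a poset, let $\Theta,\Phi$ be congruences on $(P,\le)$, and let $a,b\in P$ with $(a,b)\in\Theta$. Then: (i) there exist some $u\in\operatorname{Max}L(a,b)$ and some $v\in\operatorname{Min}U(a,b)$ with $u,v\in[a]\Theta$; (ii) $[a]\Theta$ is convex, i.e. if $x,z\in[a]\Theta$, $y\in P$ and $x\le y\le z$, then $y\in[a]\Theta$; (iii) for all $c,d\in P$: $(c,d)\in\Theta$ if and only if there exists some $(e,f)\in\Theta$ with $c,d\in[e,f]$, where $[e,f]=\{x\in P\mid e\le x\le f\}$; (iv) $\Theta=\Phi$ if and only if $\Theta\cap\{(x,y)\in P^2\mid x\le y\}=\Phi\cap\{(x,y)\in P^2\mid x\le y\}$.
   Context: For a poset $(P,\le)$ and $x,y\in P$ let $L(x,y)=\{z\in P\mid z\le x,\ z\le y\}$ and $U(x,y)=\{z\in P\mid x\le z,\ y\le z\}$; for $A\subseteq P$, $\operatorname{Max}A$ and $\operatorname{Min}A$ denote the sets of maximal and minimal elements of $A$. A binary operator on $P$ is a map $Q\colon P^2\to 2^P$; a binary relation $R$ on $P$ is compatible with $Q$ if whenever $(a_1,b_1),(a_2,b_2)\in R$ there exist $a\in Q(a_1,a_2)$ and $b\in Q(b_1,b_2)$ with $(a,b)\in R$. A congruence on $(P,\le)$ is an equivalence relation on $P$ compatible with both binary operators $(x,y)\mapsto\operatorname{Max}L(x,y)$ and $(x,y)\mapsto\operatorname{Min}U(x,y)$. $[a]\Theta$ denotes the class of $a$ under $\Theta$. -}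

module Defs where

open import Level using (Level; _⊔_)
open import Data.Product using (_×_; ∃₂)
open import Relation.Binary.Core using (Rel)
open import Relation.Binary.Structures using (IsEquivalence)
open import Relation.Binary.PropositionalEquality using (_≡_)
open import Relation.Unary using (Pred)

-- A poset is a carrier A with a relation _≤_ that is a partial order
-- with respect to propositional equality (IsPartialOrder _≡_ _≤_).
module _ {a ℓ : Level} {A : Set a} (_≤_ : Rel A ℓ) where

  L : A → A → Pred A ℓ
  L x y z = (z ≤ x) × (z ≤ y)

  U : A → A → Pred A ℓ
  U x y z = (x ≤ z) × (y ≤ z)

  Max : ∀ {s} → Pred A s → Pred A (a ⊔ ℓ ⊔ s)
  Max S z = S z × (∀ w → S w → z ≤ w → w ≡ z)

  Min : ∀ {s} → Pred A s → Pred A (a ⊔ ℓ ⊔ s)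
  Min S z = S z × (∀ w → S w → w ≤ z → w ≡ z)

  MaxL : A → A → Pred A (a ⊔ ℓ)
  MaxL x y = Max (L x y)

  MinU : A → A → Pred A (a ⊔ ℓ)
  MinU x y = Min (U x y)

  Interval : A → A → Pred A ℓ
  Interval e f x = (e ≤ x) × (x ≤ f)

Compatible : ∀ {a q r} {A : Set a} → Rel A r → (A → A → Pred A q) → Set (a ⊔ q ⊔ r)
Compatible {A = A} R Q =
  ∀ {a₁ b₁ a₂ b₂ : A} → R a₁ b₁ → R a₂ b₂ →
  ∃₂ λ a b → Q a₁ a₂ a × Q b₁ b₂ b × R a b

record IsCongruence {a ℓ r : Level} {A : Set a} (_≤_ : Rel A ℓ) (Θ : Rel A r)
       : Set (a ⊔ ℓ ⊔ r) where
  field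
    isEquivalence : IsEquivalence Θ
    compatible-MaxL : Compatible Θ (MaxL _≤_)
    compatible-MinU : Compatible Θ (MinU _≤_)

_∈[_]_ : ∀ {a r} {A : Set a} → A → A → Rel A r → Set r
y ∈[ x ] Θ = Θ x y

{-# OPTIONS --safe #-}
module Submission where

-- For comparable x ≤ y the sets Max L(x,y) and Min U(x,y) are the singletons {x} and {y}.
-- Feeding a congruence a pair together with a reflexive pair (a,a) or (y,y) therefore
-- pins down one side of the resulting related pair, which gives (i) and convexity (ii).
-- By (i), Θ-related c, d lie in the interval between a Θ-related pair from Max L(c,d)
-- and Min U(c,d); by convexity, such an interval lies in one class. This is (iii), and
-- since the pairs (e,f) in (iii) are comparable, Θ is determined by its comparable pairs (iv).

open import Defs
open import Level using (Level; _⊔_)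
open import Data.Product using (_×_; ∃; ∃₂; _,_; proj₁; proj₂)
open import Relation.Binary.Core using (Rel)
open import Relation.Binary.Definitions using (Reflexive; Transitive)
open import Relation.Binary.Structures using (IsPartialOrder; IsEquivalence)
open import Relation.Binary.PropositionalEquality using (_≡_; sym; subst; subst₂)

module _ {p ℓ : Level} {P : Set p} {_≤_ : Rel P ℓ} (≤-refl : Reflexive _≤_) where

  x≤y⇒MaxL≡x : ∀ {x y z} → x ≤ y → MaxL _≤_ x y z → z ≡ x
  x≤y⇒MaxL≡x {x} x≤y ((z≤x , _) , maximal) = sym (maximal x (≤-refl , x≤y) z≤x)

  y≤x⇒MaxL≡y : ∀ {x y z} → y ≤ x → MaxL _≤_ x y z → z ≡ y
  y≤x⇒MaxL≡y {y = y} y≤x ((_ , z≤y) , maximal) = sym (maximal y (y≤x , ≤-refl) z≤y)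

  y≤x⇒MinU≡x : ∀ {x y z} → y ≤ x → MinU _≤_ x y z → z ≡ x
  y≤x⇒MinU≡x {x} y≤x ((x≤z , _) , minimal) = sym (minimal x (≤-refl , y≤x) x≤z)

  InRelatedInterval : ∀ {r} → Rel P r → Rel P (p ⊔ ℓ ⊔ r)
  InRelatedInterval Θ c d = ∃₂ λ e f → Θ e f × Interval _≤_ e f c × Interval _≤_ e f d

  module _ {r : Level} {Θ : Rel P r} (congruence : IsCongruence _≤_ Θ) where
    open IsCongruence congruence
    open IsEquivalence isEquivalence renaming (refl to Θ-refl; sym to Θ-sym; trans to Θ-trans)

    class-meets-MaxL : ∀ {a b} → Θ a b → ∃ λ u → MaxL _≤_ a b u × u ∈[ a ] Θ
    class-meets-MaxL aΘb with compatible-MaxL Θ-refl aΘb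
    ... | a′ , u , a′∈MaxL[a,a] , u∈MaxL[a,b] , a′Θu =
      u , u∈MaxL[a,b] , subst (λ t → Θ t u) (x≤y⇒MaxL≡x ≤-refl a′∈MaxL[a,a]) a′Θu

    class-meets-MinU : ∀ {a b} → Θ a b → ∃ λ v → MinU _≤_ a b v × v ∈[ a ] Θ
    class-meets-MinU aΘb with compatible-MinU Θ-refl aΘb
    ... | a′ , v , a′∈MinU[a,a] , v∈MinU[a,b] , a′Θv =
      v , v∈MinU[a,b] , subst (λ t → Θ t v) (y≤x⇒MinU≡x ≤-refl a′∈MinU[a,a]) a′Θv

    related-below⇒related : ∀ {x y z} → Θ x z → x ≤ y → y ≤ z → Θ x y
    related-below⇒related {y = y} xΘz x≤y y≤z with compatible-MaxL xΘz (Θ-refl {y})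
    ... | u , v , u∈MaxL[x,y] , v∈MaxL[z,y] , uΘv =
      subst₂ Θ (x≤y⇒MaxL≡x x≤y u∈MaxL[x,y]) (y≤x⇒MaxL≡y y≤z v∈MaxL[z,y]) uΘv

    class-convex : ∀ {a x y z} → x ∈[ a ] Θ → z ∈[ a ] Θ → x ≤ y → y ≤ z → y ∈[ a ] Θ
    class-convex aΘx aΘz x≤y y≤z = Θ-trans aΘx (related-below⇒related (Θ-trans (Θ-sym aΘx) aΘz) x≤y y≤z)

    related⇒InRelatedInterval : ∀ {c d} → Θ c d → InRelatedInterval Θ c d
    related⇒InRelatedInterval cΘd
      with class-meets-MaxL cΘd | class-meets-MinU cΘd
    ... | u , ((u≤c , u≤d) , _) , cΘu | v , ((c≤v , d≤v) , _) , cΘv =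
      u , v , Θ-trans (Θ-sym cΘu) cΘv , (u≤c , c≤v) , (u≤d , d≤v)

    InRelatedInterval⇒related : ∀ {c d} → InRelatedInterval Θ c d → Θ c d
    InRelatedInterval⇒related (e , f , eΘf , (e≤c , c≤f) , (e≤d , d≤f)) =
      Θ-trans (Θ-sym (class-convex Θ-refl eΘf e≤c c≤f)) (class-convex Θ-refl eΘf e≤d d≤f)

  ⊆-on-comparable⇒⊆ : ∀ {r s} {Θ : Rel P r} {Φ : Rel P s} → Transitive _≤_ →
    IsCongruence _≤_ Θ → IsCongruence _≤_ Φ →
    (∀ x y → x ≤ y → Θ x y → Φ x y) → ∀ x y → Θ x y → Φ x y
  ⊆-on-comparable⇒⊆ ≤-trans congruenceΘ congruenceΦ Θ⊆Φ x y xΘy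
    with related⇒InRelatedInterval congruenceΘ xΘy
  ... | e , f , eΘf , x∈[e,f]@(e≤x , x≤f) , y∈[e,f] =
    InRelatedInterval⇒related congruenceΦ (e , f , Θ⊆Φ e f (≤-trans e≤x x≤f) eΘf , x∈[e,f] , y∈[e,f])

theorem3p2 : {p ℓ r s : Level} {P : Set p} {_≤_ : Rel P ℓ} →
    IsPartialOrder _≡_ _≤_ →
    (Θ : Rel P r) (Φ : Rel P s) →
    IsCongruence _≤_ Θ → IsCongruence _≤_ Φ →
    (a b : P) → Θ a b →
    -- (i)
    ((∃ λ u → MaxL _≤_ a b u × u ∈[ a ] Θ) × (∃ λ v → MinU _≤_ a b v × v ∈[ a ] Θ))
    -- (ii)
    × (∀ x y z → x ∈[ a ] Θ → z ∈[ a ] Θ → x ≤ y → y ≤ z → y ∈[ a ] Θ)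
    -- (iii)
    × (∀ c d → (Θ c d → ∃₂ λ e f → Θ e f × Interval _≤_ e f c × Interval _≤_ e f d)
             × ((∃₂ λ e f → Θ e f × Interval _≤_ e f c × Interval _≤_ e f d) → Θ c d))
    -- (iv)
    × (((∀ x y → Θ x y → Φ x y) × (∀ x y → Φ x y → Θ x y))
       → (∀ x y → x ≤ y → (Θ x y → Φ x y) × (Φ x y → Θ x y)))
    × ((∀ x y → x ≤ y → (Θ x y → Φ x y) × (Φ x y → Θ x y))
       → ((∀ x y → Θ x y → Φ x y) × (∀ x y → Φ x y → Θ x y)))
theorem3p2 po Θ Φ congruenceΘ congruenceΦ a b aΘb =
  (class-meets-MaxL ≤-refl congruenceΘ aΘb , class-meets-MinU ≤-refl congruenceΘ aΘb) ,
  (λ _ _ _ → class-convex ≤-refl congruenceΘ) ,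
  (λ _ _ → related⇒InRelatedInterval ≤-refl congruenceΘ , InRelatedInterval⇒related ≤-refl congruenceΘ) ,
  (λ (Θ⊆Φ , Φ⊆Θ) x y _ → Θ⊆Φ x y , Φ⊆Θ x y) ,
  (λ Θ≡Φ-on-comparable →
    ⊆-on-comparable⇒⊆ ≤-refl ≤-trans congruenceΘ congruenceΦ (λ x y x≤y → proj₁ (Θ≡Φ-on-comparable x y x≤y)) ,
    ⊆-on-comparable⇒⊆ ≤-refl ≤-trans congruenceΦ congruenceΘ (λ x y x≤y → proj₂ (Θ≡Φ-on-comparable x y x≤y)))
  where open IsPartialOrder po using () renaming (refl to ≤-refl; trans to ≤-trans)
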